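{- Let $\mathcal{G}\subseteq\mathbb{R}^n$ be a sub-module of the $\mathbb{Z}$-module $\mathbb{R}^n$, let $\mathcal{S}\subseteq\mathcal{G}$ be finite, let $\mathcal{C}$ be a chamfer mask, let $a=(a_1,\dots,a_n)\in\mathbb{Z}^n$ be such that $a_1v^1+\dots+a_nv^n\neq0$ for every vector $\vec v$ of $\mathcal{C}$, and let $\mathcal{C}_l$ ($l\in\{1,2\}$) be one of the corresponding scanning masks. Then there exists a scanning order of $\mathcal{S}$ which $\mathcal{C}_l$ supports.
   Context: A sub-module of the $\mathbb{Z}$-module $\mathbb{R}^n$ is an additive subgroup of $\mathbb{R}^n$; coordinates $\vec v=(v^1,\dots,v^n)$ are in the canonical basis. A chamfer mask is a finite set $\mathcal{C}=\{(\vec v_k,w_k)\}\subseteq\mathcal{G}\times\mathbb{Z}$ containing a basis of the $\mathbb{Z}$-module $\mathcal{G}$ among its vectors, with $w_k>0$ and $\vec v_k\ne0$, and symmetric ($(\vec v,w)\in\mathcal{C}\Rightarrow(-\vec v,w)\in\mathcal{C}$). The scanning masks are $\mathcal{C}_1=\{(\vec v,w)\in\mathcal{C}: \sum_i a_iv^i<0\}$ and $\mathcal{C}_2=\{(\vec v,w)\in\mathcal{C}:\sum_ia_iv^i>0\}$. A scanning order is an enumeration $p_1,\dots,p_M$ of the $M$ points of $\mathcal{S}$. A scanning mask $\mathcal{C}_l$ supports the scanning order if for every $i$ and every vector $\vec v$ of $\mathcal{C}_l$, either $p_i+\vec v\notin\mathcal{S}$ or $p_i+\vec v=p_{i'}$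 for some $i'<i$. -}

module Defs where

open import Level using (0ℓ)
open import Data.Nat as ℕ using (ℕ; zero; suc)
open import Data.Integer as ℤ using (ℤ; +_; -[1+_])
open import Data.Fin using (Fin)
open import Data.Vec using (Vec; []; _∷_; zipWith; replicate; lookup; foldr)
open import Data.List using (List; length)
open import Data.List.Membership.Propositional using (_∈_)
open import Data.List.Relation.Unary.Unique.Propositional using (Unique)
open import Data.List.Relation.Binary.Permutation.Propositional using (_↭_)
open import Data.Product using (Σ; ∃; _×_; _,_)
open import Data.Sum using (_⊎_)
open import Data.Empty using (⊥)
open import Relation.Nullary using (¬_)
open import Relation.Binary.PropositionalEquality using (_≡_)
open import Algebra.Structures using (IsCommutativeRing)

-- The real numbers, given axiomatically as a complete ordered field
-- (any two such structures are isomorphic, so quantifying over all of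
-- them is the same as speaking about ℝ).

record RealField : Set₁ where
  infixl 6 _+_
  infixl 7 _*_
  infix  4 _<_ _≤_
  field
    Carrier : Set
    _+_ _*_ : Carrier → Carrier → Carrier
    -_      : Carrier → Carrier
    0# 1#   : Carrier
    isCommutativeRing : IsCommutativeRing _≡_ _+_ _*_ -_ 0# 1#
    0≢1     : ¬ (0# ≡ 1#)
    inverse : ∀ x → ¬ (x ≡ 0#) → ∃ λ y → x * y ≡ 1#
    _<_     : Carrier → Carrier → Set
    <-irrefl : ∀ x → ¬ (x < x)
    <-trans  : ∀ {x y z} → x < y → y < z → x < z
    <-trichotomy : ∀ x y → x < y ⊎ (x ≡ y ⊎ y < x)
    +-mono-< : ∀ {x y} z → x < y → x + z < y + z
    *-pos    : ∀ {x y} → 0# < x → 0# < y → 0# < x * y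

  _≤_ : Carrier → Carrier → Set
  x ≤ y = x < y ⊎ x ≡ y

  field
    sup : (P : Carrier → Set) → (∃ λ x → P x) →
          (∃ λ b → ∀ x → P x → x ≤ b) →
          ∃ λ s → (∀ x → P x → x ≤ s) × (∀ b → (∀ x → P x → x ≤ b) → s ≤ b)

module RealVectors (R : RealField) where
  open RealField R

  fromℕ : ℕ → Carrier
  fromℕ zero    = 0#
  fromℕ (suc k) = 1# + fromℕ k

  fromℤ : ℤ → Carrier
  fromℤ (+ k)      = fromℕ k
  fromℤ -[1+ k ]   = - (1# + fromℕ k)

  Rⁿ : ℕ → Set
  Rⁿ n = Vec Carrier n

  _⊕_ : ∀ {n} → Rⁿ n → Rⁿ n → Rⁿ n
  u ⊕ v = zipWith _+_ u v

  ⊖_ : ∀ {n} → Rⁿ n → Rⁿ n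
  ⊖ v = Data.Vec.map -_ v

  𝟎 : ∀ {n} → Rⁿ n
  𝟎 = replicate _ 0#

  _·_ : ∀ {n} → ℤ → Rⁿ n → Rⁿ n
  c · v = Data.Vec.map (λ x → fromℤ c * x) v

  dot : ∀ {n} → Vec ℤ n → Rⁿ n → Carrier
  dot a v = foldr _ _+_ 0# (zipWith (λ c x → fromℤ c * x) a v)

  lincomb : ∀ {n} k → (Fin k → ℤ) → (Fin k → Rⁿ n) → Rⁿ n
  lincomb zero    c b = 𝟎
  lincomb (suc k) c b = (c Fin.zero · b Fin.zero) ⊕ lincomb k (λ i → c (Fin.suc i)) (λ i → b (Fin.suc i))
    where import Data.Fin as Fin

  record SubModule (n : ℕ) : Set₁ where
    field
      member : Rⁿ n → Set
      has-0  : member 𝟎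
      closed-+ : ∀ {u v} → member u → member v → member (u ⊕ v)
      closed-neg : ∀ {u} → member u → member (⊖ u)
  open SubModule public

  IsBasis : ∀ {n} → SubModule n → (k : ℕ) → (Fin k → Rⁿ n) → Set
  IsBasis G k b =
    (∀ i → member G (b i)) ×
    (∀ g → member G g → ∃ λ c → g ≡ lincomb k c b) ×
    (∀ c → lincomb k c b ≡ 𝟎 → ∀ i → c i ≡ + 0)

  record ChamferMask {n} (G : SubModule n) : Set₁ where
    field
      mask : List (Rⁿ n × ℤ)
      in-G : ∀ {v w} → (v , w) ∈ mask → member G v
      weight-pos : ∀ {v w} → (v , w) ∈ mask → ℤ.0ℤ ℤ.< w
      vector-nonzero : ∀ {v w} → (v , w) ∈ mask → ¬ (v ≡ 𝟎)
      symmetric : ∀ {v w} → (v , w) ∈ mask → (⊖ v , w) ∈ mask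
      basis : ∃ λ k → ∃ λ (b : Fin k → Rⁿ n) → IsBasis G k b ×
                (∀ i → ∃ λ w → (b i , w) ∈ mask)
  open ChamferMask public

  -- membership in the scanning mask C_l, l ∈ {1,2}  (Fin 2: zero ↦ C₁, suc zero ↦ C₂)
  InScanningMask : ∀ {n} {G : SubModule n} → ChamferMask G → Vec ℤ n → Fin 2 →
                   Rⁿ n × ℤ → Set
  InScanningMask C a Fin.zero (v , w) = (v , w) ∈ mask C × dot a v < 0#
    where import Data.Fin as Fin
  InScanningMask C a (Fin.suc _) (v , w) = (v , w) ∈ mask C × 0# < dot a v
    where import Data.Fin as Fin

  ScanningOrder : ∀ {n} → List (Rⁿ n) → List (Rⁿ n) → Set
  ScanningOrder S order = order ↭ S

  Supports : ∀ {n} {G : SubModule n} → ChamferMask G → Vec ℤ n → Fin 2 →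
             List (Rⁿ n) → List (Rⁿ n) → Set
  Supports {n} C a l S order =
    ∀ (i : Fin (length order)) (v : Rⁿ n) (w : ℤ) → InScanningMask C a l (v , w) →
      ¬ ((Data.List.lookup order i ⊕ v) ∈ S) ⊎
      (∃ λ (i' : Fin (length order)) → (i' Data.Fin.< i) ×
          (Data.List.lookup order i ⊕ v ≡ Data.List.lookup order i'))

-- Order the points of S by the value of the linear form x ↦ a·x, increasingly
-- for C₁ and decreasingly for C₂.  Every vector v of C_l moves a point p
-- strictly backwards in this order, since a·(p + v) = a·p + a·v, so a point
-- p + v that lies in S has already been enumerated before p.
module Submission where

open import Defs
open import Level using (Level)
open import Data.Nat using (ℕ)
import Data.Nat.Properties as ℕ
open import Data.Integer using (ℤ)
open import Data.Fin using (Fin; zero; suc)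
import Data.Fin as Fin
open import Data.Vec using (Vec; []; _∷_)
import Data.Vec.Properties as Vec
open import Data.List using (List; length; lookup)
open import Data.List.Membership.Propositional using (_∈_)
import Data.List.Membership.DecPropositional as DecMembership
open import Data.List.Relation.Unary.Any using (index)
open import Data.List.Relation.Unary.Any.Properties using (lookup-index)
open import Data.List.Relation.Unary.Unique.Propositional using (Unique)
open import Data.List.Relation.Binary.Permutation.Propositional using (↭-sym)
open import Data.List.Relation.Binary.Permutation.Propositional.Properties
  using (∈-resp-↭)
open import Data.List.Relation.Unary.Sorted.TotalOrder using (Sorted)
open import Data.List.Relation.Unary.Sorted.TotalOrder.Properties using (lookup-mono-≤)
import Data.List.Sort as Sort
open import Data.Product using (∃; _×_; _,_)
open import Data.Sum using (inj₁; inj₂)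
open import Relation.Nullary using (¬_; yes; no; contradiction)
open import Relation.Binary.Bundles using (TotalOrder; DecTotalOrder; StrictTotalOrder)
open import Relation.Binary.Definitions using (Trichotomous; tri<; tri≈; tri>)
import Relation.Binary.Construct.On as On
import Relation.Binary.Construct.Flip.EqAndOrd as Flip
import Relation.Binary.Properties.StrictTotalOrder as StrictTotalOrderProperties
open import Relation.Binary.PropositionalEquality
open import Algebra.Bundles using (CommutativeRing)
import Algebra.Properties.CommutativeSemigroup as CommutativeSemigroupProperties

module _ {a ℓ₁ ℓ₂ : Level} (O : TotalOrder a ℓ₁ ℓ₂) where
  open TotalOrder O

  lookup-index-<-if-below : ∀ {xs} → Sorted O xs → ∀ i {q} → q ∈ xs → ¬ (lookup xs i ≤ q) →
                            ∃ λ j → j Fin.< i × lookup xs j ≡ q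
  lookup-index-<-if-below {xs} xs↗ i q∈xs xᵢ≰q with index q∈xs Fin.<? i
  ... | yes j<i = index q∈xs , j<i , sym (lookup-index q∈xs)
  ... | no  j≮i = contradiction
    (subst (lookup xs i ≤_) (sym (lookup-index q∈xs)) (lookup-mono-≤ O xs↗ (ℕ.≮⇒≥ j≮i)))
    xᵢ≰q

module _ (R : RealField) where
  open RealField R
  open RealVectors R

  <-compare : Trichotomous _≡_ _<_
  <-compare x y with <-trichotomy x y
  ... | inj₁ x<y        = tri< x<y (λ { refl → <-irrefl x x<y }) (λ y<x → <-irrefl x (<-trans x<y y<x))
  ... | inj₂ (inj₁ x≡y) = tri≈ (λ x<y → <-irrefl x (subst (x <_) (sym x≡y) x<y)) x≡y
                               (λ y<x → <-irrefl x (subst (_< x) (sym x≡y) y<x))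
  ... | inj₂ (inj₂ y<x) = tri> (λ x<y → <-irrefl x (<-trans x<y y<x)) (λ { refl → <-irrefl x y<x }) y<x

  <-strictTotalOrder : StrictTotalOrder _ _ _
  <-strictTotalOrder = record
    { isStrictTotalOrder = record
      { isStrictPartialOrder = record
        { isEquivalence = isEquivalence
        ; irrefl        = λ { refl → <-irrefl _ }
        ; trans         = <-trans
        ; <-resp-≈      = (λ { refl x<y → x<y }) , (λ { refl x<y → x<y })
        }
      ; compare = <-compare
      }
    }

  ≤-decTotalOrder : DecTotalOrder _ _ _
  ≤-decTotalOrder = StrictTotalOrderProperties.decTotalOrder <-strictTotalOrder

  <⇒≱ : ∀ {x y} → x < y → ¬ (y ≤ x)
  <⇒≱ x<y (inj₁ y<x) = <-irrefl _ (<-trans x<y y<x)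
  <⇒≱ x<y (inj₂ refl) = <-irrefl _ x<y

  private
    ring : CommutativeRing _ _
    ring = record { isCommutativeRing = isCommutativeRing }
    module Ring = CommutativeRing ring
    open CommutativeSemigroupProperties Ring.+-commutativeSemigroup using (interchange)

  dot-⊕ : ∀ {m} (b : Vec ℤ m) (p v : Rⁿ m) → dot b (p ⊕ v) ≡ dot b p + dot b v
  dot-⊕ []      []      []      = sym (Ring.+-identityˡ 0#)
  dot-⊕ (c ∷ b) (x ∷ p) (y ∷ v) = begin
    fromℤ c * (x + y) + dot b (p ⊕ v)                   ≡⟨ cong₂ _+_ (Ring.distribˡ (fromℤ c) x y) (dot-⊕ b p v) ⟩
    (fromℤ c * x + fromℤ c * y) + (dot b p + dot b v)   ≡⟨ interchange _ _ _ _ ⟩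
    (fromℤ c * x + dot b p) + (fromℤ c * y + dot b v)   ∎
    where open ≡-Reasoning

  +-neg-< : ∀ x {y} → y < 0# → x + y < x
  +-neg-< x y<0 = subst₂ _<_ (Ring.+-comm _ x) (Ring.+-identityˡ x) (+-mono-< x y<0)

  +-pos-> : ∀ x {y} → 0# < y → x < x + y
  +-pos-> x 0<y = subst₂ _<_ (Ring.+-identityˡ x) (Ring.+-comm _ x) (+-mono-< x 0<y)

  module _ {n} {G : SubModule n} (S : List (Rⁿ n)) (C : ChamferMask G) (a : Vec ℤ n) (l : Fin 2) where

    sort-by-key-supports :
      ∀ {k ℓ₁ ℓ₂} (O : DecTotalOrder k ℓ₁ ℓ₂) (key : Rⁿ n → DecTotalOrder.Carrier O) →
      (∀ p {v w} → InScanningMask C a l (v , w) → ¬ DecTotalOrder._≤_ O (key p) (key (p ⊕ v))) →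
      ∃ λ order → ScanningOrder S order × Supports C a l S order
    sort-by-key-supports O key descends = sort S , sort-↭ S , supports
      where
      O-on-key : DecTotalOrder _ _ _
      O-on-key = On.decTotalOrder O key
      open Sort O-on-key using (sort; sort-↭; sort-↗)
      open DecMembership (Vec.≡-dec (StrictTotalOrder._≟_ <-strictTotalOrder)) using (_∈?_)

      supports : Supports C a l S (sort S)
      supports i v w v∈Cₗ with lookup (sort S) i ⊕ v ∈? S
      ... | no  p+v∉S = inj₁ p+v∉S
      ... | yes p+v∈S with lookup-index-<-if-below (DecTotalOrder.totalOrder O-on-key) (sort-↗ S) i
                              (∈-resp-↭ (↭-sym (sort-↭ S)) p+v∈S) (descends _ v∈Cₗ)
      ...   | j , j<i , pⱼ≡p+v = inj₂ (j , j<i , sym pⱼ≡p+v)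

proposition3p1 : (R : RealField) → let open RealVectors R in
    (n : ℕ) (G : SubModule n) (S : List (Rⁿ n)) → Unique S → (∀ {p} → p ∈ S → member G p) →
    (C : ChamferMask G) (a : Vec ℤ n) →
    (∀ {v w} → (v , w) ∈ mask C → ¬ (dot a v ≡ RealField.0# R)) →
    (l : Fin 2) →
    ∃ λ order → ScanningOrder S order × Supports C a l S order
proposition3p1 R n G S _ _ C a _ zero =
  sort-by-key-supports R S C a zero (≤-decTotalOrder R) (dot a)
    λ p (_ , a·v<0) → <⇒≱ R (subst (_< dot a p) (sym (dot-⊕ R a p _)) (+-neg-< R _ a·v<0))
  where open RealField R; open RealVectors R
proposition3p1 R n G S _ _ C a _ (suc zero) =
  sort-by-key-supports R S C a (suc zero) (Flip.decTotalOrder (≤-decTotalOrder R)) (dot a)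
    λ p (_ , 0<a·v) → <⇒≱ R (subst (dot a p <_) (sym (dot-⊕ R a p _)) (+-pos-> R _ 0<a·v))
  where open RealField R; open RealVectors R
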